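{- For all integers $n\ge 2$, $k\ge 0$ and $0\le j\le n-1$, $$|OLA^+_{P_n}(k,j)|\le 2^{0.119n+1.96k-0.967095j+2}.$$ Furthermore, with $d_2=0.497534$, $$|OLA^+_{P_n}(k,2)|\le (1-d_2)\,2^{0.119n+1.96k-2\cdot 0.967095+2}.$$
   Context: Let $P_n=p_1p_2\dots p_n$ be a path on $n$ vertices. A linear arrangement of $P_n$ is a bijection $\alpha:V(P_n)\to\{1,\dots,n\}$, and its net cost is $\sum_{i=1}^{n-1}(|\alpha(p_i)-\alpha(p_{i+1})|-1)$. For nonnegative integers $k,j$, $OLA^+_{P_n}(k,j)$ denotes the set of linear arrangements $\alpha$ of $P_n$ with net cost at most $k$ such that $\alpha(p_1)=j$ and $\alpha(p_n)=n$. -}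

module Defs where

open import Data.Nat using (ℕ; zero; suc; _+_; _*_; _∸_; _^_; _≤_; ∣_-_∣)
open import Data.Fin using (Fin; toℕ)
open import Data.Vec using (Vec; toList)
open import Data.List using (List; []; _∷_; _++_; map; [_])
open import Data.List.Relation.Unary.Unique.Propositional using (Unique)
open import Data.Product using (_×_; ∃)
open import Relation.Binary.PropositionalEquality using (_≡_)

-- A linear arrangement α of P_n = p_1 … p_n is represented by the vector
-- (α(p_1), …, α(p_n)), where the entry x : Fin n stands for position toℕ x + 1
-- in {1,…,n}.  Bijectivity = the entries are pairwise distinct (an injection
-- Fin n → Fin n is a bijection).
Arrangement : ℕ → Set
Arrangement n = Vec (Fin n) n

IsLinearArrangement : ∀ {n} → Arrangement n → Set
IsLinearArrangement v = Unique (toList v)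

positions : ∀ {n} → Arrangement n → List ℕ
positions v = map (λ x → suc (toℕ x)) (toList v)

netCost : List ℕ → ℕ
netCost (a ∷ b ∷ rest) = (∣ a - b ∣ ∸ 1) + netCost (b ∷ rest)
netCost _ = 0

InOLA⁺ : (n k j : ℕ) → Arrangement n → Set
InOLA⁺ n k j v =
  IsLinearArrangement v ×
  netCost (positions v) ≤ k ×
  (∃ λ ys → positions v ≡ j ∷ ys) ×
  (∃ λ xs → positions v ≡ xs ++ [ n ])

-- Denominator for the decimal exponents (all constants have ≤ 6 decimals).
D : ℕ
D = 1000000

module Submission where

-- Weight each arrangement by x ^ (net cost) with x ≈ 2 ^ -1.96, and let W(n, j) be the total weight of
-- the arrangements of Pₙ that start at j and end at n.  Deleting the first vertex and closing the gap
-- at position j maps such an arrangement injectively to one of Pₙ₋₁ that starts at some κ and ends at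
-- n − 1, and lowers the net cost by at least deletionCost j κ.  Sorting by κ gives
--   W(n, j) ≤ Σ_κ x ^ deletionCost j κ · W(n − 1, κ),
-- and by induction W(n, j) ≤ 4 ρⁿ δʲ with ρ ≈ 2 ^ 0.119, δ ≈ 2 ^ -0.967095, sharpened to 4 ρⁿ x δ for
-- j = 2; the inductive step is a pair of geometric series.  An arrangement of net cost at most k weighs
-- at least x ^ k, so |OLA⁺(k, j)| ≤ W(n, j) / x ^ k, and comparing the rational constants with the
-- decimal exponents of the statement is exact integer arithmetic.

module Lists where

  open import Data.Maybe.Base using (just)
  open import Data.Product.Base using (proj₁; proj₂)
  open import Data.List.Base using (List; []; _∷_; _++_; [_]; map; head; last)
  open import Data.List.Properties using (∷-injective)
  open import Data.List.Relation.Unary.All as All using (All; []; _∷_)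
  open import Data.List.Relation.Unary.Unique.Propositional using (Unique; []; _∷_)
  open import Data.List.Relation.Unary.Any using (here; there)
  open import Data.List.Membership.Propositional using (_∈_)
  open import Relation.Binary.PropositionalEquality hiding ([_])
  open import Relation.Nullary using (¬_)

  head-∈ : ∀ {A : Set} {a : A} l → head l ≡ just a → a ∈ l
  head-∈ (_ ∷ _) refl = here refl

  last-∈ : ∀ {A : Set} {z : A} l → last l ≡ just z → z ∈ l
  last-∈ (a ∷ [])    refl = here refl
  last-∈ (a ∷ b ∷ l) eq   = there (last-∈ (b ∷ l) eq)

  last-++-singleton : ∀ {A : Set} (xs : List A) z → last (xs ++ [ z ]) ≡ just z
  last-++-singleton []           z = refl
  last-++-singleton (_ ∷ [])     z = refl
  last-++-singleton (_ ∷ y ∷ xs) z = last-++-singleton (y ∷ xs) z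

  ∉⇒All≢ : ∀ {A : Set} {y : A} {l} → ¬ y ∈ l → All (_≢ y) l
  ∉⇒All≢ y∉l = All.tabulate λ x∈l x≡y → y∉l (subst (_∈ _) x≡y x∈l)

  module _ {A B : Set} {P : A → Set} (f : A → B)
           (inj : ∀ {a b} → P a → P b → f a ≡ f b → a ≡ b) where

    map-injectiveOn : ∀ {xs ys} → All P xs → All P ys → map f xs ≡ map f ys → xs ≡ ys
    map-injectiveOn []         []         _  = refl
    map-injectiveOn (px ∷ pxs) (py ∷ pys) eq =
      cong₂ _∷_ (inj px py (proj₁ (∷-injective eq))) (map-injectiveOn pxs pys (proj₂ (∷-injective eq)))

    Unique-map-injectiveOn : ∀ {xs} → All P xs → Unique xs → Unique (map f xs)
    Unique-map-injectiveOn         []         []         = []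
    Unique-map-injectiveOn {x ∷ _} (px ∷ pxs) (x∉xs ∷ u) = map-≢ pxs x∉xs ∷ Unique-map-injectiveOn pxs u
      where
      map-≢ : ∀ {ys} → All P ys → All (x ≢_) ys → All (f x ≢_) (map f ys)
      map-≢ []         []           = []
      map-≢ (py ∷ pys) (x≢y ∷ x≢ys) = (λ fx≡fy → x≢y (inj px py fx≡fy)) ∷ map-≢ pys x≢ys


module RationalSums where

  open import Algebra.Bundles using (CommutativeRing)
  open import Data.Nat.Base as ℕ using (ℕ; zero; suc; z≤n; s≤s)
  import Data.Nat.Properties as ℕ
  open import Data.Bool.Base using (true; false)
  open import Data.List.Base using (List; []; _∷_; _++_; map; filter; applyUpTo)
  open import Data.List.Properties using (filter-accept)
  open import Data.List.Relation.Unary.All as All using (All; []; _∷_)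
  open import Data.List.Relation.Unary.Any using (here; there)
  open import Data.List.Membership.Propositional using (_∈_)
  open import Data.Rational.Unnormalised.Base
  open import Data.Rational.Unnormalised.Properties
  open import Data.Rational.Unnormalised.Solver using (module +-*-Solver)
  open import Relation.Binary.PropositionalEquality using (_≡_; refl; cong)
  open import Relation.Nullary using (does)
  open import Algebra.Properties.CommutativeSemiring.Exp
    (CommutativeRing.commutativeSemiring +-*-commutativeRing) public
    using (_^_; ^-homo-*; ^-distrib-*)
  open +-*-Solver
  open ≤-Reasoning

  *-nonNeg : ∀ {p q} → 0ℚᵘ ≤ p → 0ℚᵘ ≤ q → 0ℚᵘ ≤ p * q
  *-nonNeg {p} {q} 0≤p 0≤q =
    ≤-respˡ-≃ (*-zeroˡ q) (*-monoˡ-≤-nonNeg q {{nonNegative 0≤q}} 0≤p)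

  +-nonNeg : ∀ {p q} → 0ℚᵘ ≤ p → 0ℚᵘ ≤ q → 0ℚᵘ ≤ p + q
  +-nonNeg = +-mono-≤

  ^-nonNeg : ∀ {p} n → 0ℚᵘ ≤ p → 0ℚᵘ ≤ p ^ n
  ^-nonNeg zero    0≤p = ≤ᵇ⇒≤ _
  ^-nonNeg (suc n) 0≤p = *-nonNeg 0≤p (^-nonNeg n 0≤p)

  *-monoʳ-≤-0≤ : ∀ {p q} r → 0ℚᵘ ≤ r → p ≤ q → r * p ≤ r * q
  *-monoʳ-≤-0≤ r 0≤r = *-monoʳ-≤-nonNeg r {{nonNegative 0≤r}}

  *-mono-≤-0≤ : ∀ {p q r s} → 0ℚᵘ ≤ p → 0ℚᵘ ≤ r → p ≤ q → r ≤ s → p * r ≤ q * s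
  *-mono-≤-0≤ 0≤p 0≤r = *-mono-≤-nonNeg {{nonNegative 0≤p}} {{nonNegative 0≤r}}

  p≤1⇒p^n≤1 : ∀ {p} n → 0ℚᵘ ≤ p → p ≤ 1ℚᵘ → p ^ n ≤ 1ℚᵘ
  p≤1⇒p^n≤1     zero    _   _   = ≤-refl
  p≤1⇒p^n≤1 {p} (suc n) 0≤p p≤1 = begin
    p * p ^ n   ≤⟨ *-mono-≤-0≤ 0≤p (^-nonNeg n 0≤p) p≤1 (p≤1⇒p^n≤1 n 0≤p p≤1) ⟩
    1ℚᵘ * 1ℚᵘ   ≃⟨ *-identityˡ 1ℚᵘ ⟩
    1ℚᵘ         ∎

  ^-antimonoʳ-≤ : ∀ {p m n} → 0ℚᵘ ≤ p → p ≤ 1ℚᵘ → m ℕ.≤ n → p ^ n ≤ p ^ m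
  ^-antimonoʳ-≤ {p} {m} {n} 0≤p p≤1 m≤n = begin
    p ^ n                   ≡⟨ cong (p ^_) (ℕ.m+[n∸m]≡n m≤n) ⟨
    p ^ (m ℕ.+ (n ℕ.∸ m))   ≃⟨ ^-homo-* p m (n ℕ.∸ m) ⟩
    p ^ m * p ^ (n ℕ.∸ m)
      ≤⟨ *-monoʳ-≤-0≤ (p ^ m) (^-nonNeg m 0≤p) (p≤1⇒p^n≤1 (n ℕ.∸ m) 0≤p p≤1) ⟩
    p ^ m * 1ℚᵘ             ≃⟨ *-identityʳ (p ^ m) ⟩
    p ^ m                   ∎

  sumOver : {A : Set} → (A → ℚᵘ) → List A → ℚᵘ
  sumOver f []       = 0ℚᵘ
  sumOver f (a ∷ as) = f a + sumOver f as

  infix 6.5 sumOver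
  syntax sumOver (λ a → e) L = ∑[ a ∈ L ] e

  module _ {A : Set} where

    sum-nonNeg : (f : A → ℚᵘ) → (∀ a → 0ℚᵘ ≤ f a) → ∀ L → 0ℚᵘ ≤ ∑[ a ∈ L ] f a
    sum-nonNeg f 0≤f []      = ≤-refl
    sum-nonNeg f 0≤f (a ∷ L) = +-nonNeg (0≤f a) (sum-nonNeg f 0≤f L)

    sum-mono : {f g : A → ℚᵘ} → (∀ a → f a ≤ g a) → ∀ L →
               ∑[ a ∈ L ] f a ≤ ∑[ a ∈ L ] g a
    sum-mono f≤g []      = ≤-refl
    sum-mono f≤g (a ∷ L) = +-mono-≤ (f≤g a) (sum-mono f≤g L)

    sum-cong : {f g : A → ℚᵘ} {L : List A} → All (λ a → f a ≃ g a) L →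
               ∑[ a ∈ L ] f a ≃ ∑[ a ∈ L ] g a
    sum-cong []            = ≃-refl
    sum-cong (fa≃ga ∷ f≃g) = +-cong fa≃ga (sum-cong f≃g)

    sum-+ : (f g : A → ℚᵘ) → ∀ L →
            ∑[ a ∈ L ] (f a + g a) ≃ ∑[ a ∈ L ] f a + ∑[ a ∈ L ] g a
    sum-+ f g []      = ≃-sym (+-identityˡ 0ℚᵘ)
    sum-+ f g (a ∷ L) = begin-equality
      (f a + g a) + ∑[ b ∈ L ] (f b + g b)              ≃⟨ +-congʳ (f a + g a) (sum-+ f g L) ⟩
      (f a + g a) + (∑[ b ∈ L ] f b + ∑[ b ∈ L ] g b)
        ≃⟨ solve 4 (λ u v s t → (u :+ v) :+ (s :+ t) := (u :+ s) :+ (v :+ t)) ≃-refl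
             (f a) (g a) (∑[ b ∈ L ] f b) (∑[ b ∈ L ] g b) ⟩
      (f a + ∑[ b ∈ L ] f b) + (g a + ∑[ b ∈ L ] g b)   ∎

    sum-*ˡ : ∀ c (f : A → ℚᵘ) L → ∑[ a ∈ L ] (c * f a) ≃ c * (∑[ a ∈ L ] f a)
    sum-*ˡ c f []      = ≃-sym (*-zeroʳ c)
    sum-*ˡ c f (a ∷ L) = begin-equality
      c * f a + ∑[ b ∈ L ] (c * f b)   ≃⟨ +-congʳ (c * f a) (sum-*ˡ c f L) ⟩
      c * f a + c * (∑[ b ∈ L ] f b)   ≃⟨ *-distribˡ-+ c (f a) _ ⟨
      c * (f a + ∑[ b ∈ L ] f b)       ∎

    sum-++ : (f : A → ℚᵘ) → ∀ K L → ∑[ a ∈ K ++ L ] f a ≃ ∑[ a ∈ K ] f a + ∑[ a ∈ L ] f a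
    sum-++ f []      L = ≃-sym (+-identityˡ _)
    sum-++ f (a ∷ K) L = ≃-trans (+-congʳ (f a) (sum-++ f K L)) (≃-sym (+-assoc (f a) _ _))

    ∈⇒≤sum : (f : A → ℚᵘ) → (∀ a → 0ℚᵘ ≤ f a) → ∀ {a L} → a ∈ L →
             f a ≤ ∑[ b ∈ L ] f b
    ∈⇒≤sum f 0≤f {L = b ∷ L} (here refl) = p≤p+q (f b) _ {{nonNegative (sum-nonNeg f 0≤f L)}}
    ∈⇒≤sum f 0≤f {L = b ∷ L} (there a∈L) =
      p≤q⇒p≤r+q (f b) {{nonNegative (0≤f b)}} (∈⇒≤sum f 0≤f a∈L)

  sum-map : ∀ {A B : Set} (f : B → ℚᵘ) (g : A → B) L → ∑[ b ∈ map g L ] f b ≡ ∑[ a ∈ L ] f (g a)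
  sum-map f g []      = refl
  sum-map f g (a ∷ L) = cong (f (g a) +_) (sum-map f g L)

  sum-geometric : ∀ {r G} → 0ℚᵘ ≤ r → 0ℚᵘ ≤ G → 1ℚᵘ + r * G ≤ G →
                  ∀ (f : ℕ → ℚᵘ) g m {c} → 0ℚᵘ ≤ c →
                  (∀ i → i ℕ.< m → f (g i) ≤ c * r ^ i) → ∑[ κ ∈ applyUpTo g m ] f κ ≤ c * G
  sum-geometric 0≤r 0≤G _ f g zero {c} 0≤c _ = *-nonNeg 0≤c 0≤G
  sum-geometric {r} {G} 0≤r 0≤G 1+rG≤G f g (suc m) {c} 0≤c f≤ = begin
    f (g 0) + ∑[ κ ∈ applyUpTo (λ i → g (suc i)) m ] f κ
      ≤⟨ +-mono-≤ (≤-trans (f≤ 0 (s≤s z≤n)) (≤-reflexive (*-identityʳ c)))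
                  (sum-geometric 0≤r 0≤G 1+rG≤G f (λ i → g (suc i)) m (*-nonNeg 0≤c 0≤r) tail≤) ⟩
    c + c * r * G       ≃⟨ solve 3 (λ c r G → c :+ c :* r :* G := c :* (con 1ℚᵘ :+ r :* G)) ≃-refl c r G ⟩
    c * (1ℚᵘ + r * G)   ≤⟨ *-monoʳ-≤-0≤ c 0≤c 1+rG≤G ⟩
    c * G               ∎
    where
    tail≤ : ∀ i → i ℕ.< m → f (g (suc i)) ≤ c * r * r ^ i
    tail≤ i i<m = ≤-trans (f≤ (suc i) (s≤s i<m)) (≤-reflexive (≃-sym (*-assoc c r (r ^ i))))

  module _ {A : Set} (key : A → ℕ) where

    fibre : ℕ → List A → List A
    fibre κ = filter (λ a → key a ℕ.≟ κ)

    private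
      sum-fibre-∷ : (w : A → ℚᵘ) → ∀ κ a L →
        ∑[ b ∈ fibre κ (a ∷ L) ] w b ≃ ∑[ b ∈ fibre κ (a ∷ []) ] w b + ∑[ b ∈ fibre κ L ] w b
      sum-fibre-∷ w κ a L with does (key a ℕ.≟ κ)
      ... | true  = +-congˡ _ (≃-sym (+-identityʳ (w a)))
      ... | false = ≃-sym (+-identityˡ _)

      ≤sum-fibres-singleton : (w : A → ℚᵘ) → (∀ a → 0ℚᵘ ≤ w a) → ∀ {K} a → key a ∈ K →
                              w a ≤ ∑[ κ ∈ K ] ∑[ b ∈ fibre κ (a ∷ []) ] w b
      ≤sum-fibres-singleton w 0≤w {K} a key∈K = begin
        w a                                        ≃⟨ +-identityʳ (w a) ⟨
        ∑[ b ∈ a ∷ [] ] w b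
          ≡⟨ cong (sumOver w) (filter-accept (λ b → key b ℕ.≟ key a) refl) ⟨
        ∑[ b ∈ fibre (key a) (a ∷ []) ] w b
          ≤⟨ ∈⇒≤sum (λ κ → ∑[ b ∈ fibre κ (a ∷ []) ] w b)
                    (λ κ → sum-nonNeg w 0≤w (fibre κ (a ∷ []))) key∈K ⟩
        ∑[ κ ∈ K ] ∑[ b ∈ fibre κ (a ∷ []) ] w b   ∎

    sum≤sum-fibres : (w : A → ℚᵘ) → (∀ a → 0ℚᵘ ≤ w a) → ∀ K L → All (λ a → key a ∈ K) L →
                     ∑[ a ∈ L ] w a ≤ ∑[ κ ∈ K ] ∑[ a ∈ fibre κ L ] w a
    sum≤sum-fibres w 0≤w K []      []               = sum-nonNeg _ (λ _ → ≤-refl) K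
    sum≤sum-fibres w 0≤w K (a ∷ L) (key∈K ∷ keys∈K) = begin
      w a + ∑[ b ∈ L ] w b
        ≤⟨ +-mono-≤ (≤sum-fibres-singleton w 0≤w a key∈K) (sum≤sum-fibres w 0≤w K L keys∈K) ⟩
      ∑[ κ ∈ K ] ∑[ b ∈ fibre κ (a ∷ []) ] w b + ∑[ κ ∈ K ] ∑[ b ∈ fibre κ L ] w b
        ≃⟨ sum-+ (λ κ → ∑[ b ∈ fibre κ (a ∷ []) ] w b) (λ κ → ∑[ b ∈ fibre κ L ] w b) K ⟨
      ∑[ κ ∈ K ] (∑[ b ∈ fibre κ (a ∷ []) ] w b + ∑[ b ∈ fibre κ L ] w b)
        ≃⟨ sum-cong (All.universal (λ κ → sum-fibre-∷ w κ a L) K) ⟨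
      ∑[ κ ∈ K ] ∑[ b ∈ fibre κ (a ∷ L) ] w b ∎

module Compression where

  open import Data.Nat.Base
  open import Data.Nat.Properties
  open import Data.Bool.Base using (Bool; true; false; _xor_; if_then_else_)
  import Data.Bool.Properties as Bool
  open import Data.Maybe.Base using (just)
  open import Data.Product.Base using (_×_; _,_)
  open import Data.List.Base using (List; []; _∷_; map; last)
  open import Data.List.Relation.Unary.All using (All; []; _∷_)
  open import Data.List.Relation.Unary.Any using (here; there)
  open import Data.List.Membership.Propositional using (_∈_)
  open import Relation.Binary.PropositionalEquality
  open import Relation.Binary.Definitions using (tri<; tri≈; tri>)
  open import Relation.Nullary using (does; yes; no; contradiction)
  open import Relation.Nullary.Decidable using (dec-true; dec-false)
  open import Algebra.Properties.CommutativeSemigroup +-commutativeSemigroup using (interchange)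
  open import Defs using (netCost)
  open Lists using (last-∈)

  module _ {A : Set} (s : A → Bool) where

    changes : List A → ℕ
    changes (a ∷ b ∷ r) = (if s a xor s b then 1 else 0) + changes (b ∷ r)
    changes _           = 0

    private
      change-≢ : ∀ {a b} → s a ≢ s b → (if s a xor s b then 1 else 0) ≡ 1
      change-≢ {a} {b} sa≢sb with s a | s b
      ... | true  | false = refl
      ... | false | true  = refl
      ... | true  | true  = contradiction refl sa≢sb
      ... | false | false = contradiction refl sa≢sb

      ∈-tail : ∀ {a b r} → b ∈ a ∷ r → s a ≢ s b → b ∈ r
      ∈-tail (here refl) sa≢sb = contradiction refl sa≢sb
      ∈-tail (there b∈r) _     = b∈r

    changes-≥1 : ∀ {a b} r → b ∈ a ∷ r → s a ≢ s b → 1 ≤ changes (a ∷ r)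
    changes-≥1     []       b∈ sa≢sb = contradiction (∈-tail b∈ sa≢sb) λ ()
    changes-≥1 {a} (a₂ ∷ r) b∈ sa≢sb with s a Bool.≟ s a₂
    ... | yes sa≡sa₂ = ≤-trans (changes-≥1 r (∈-tail b∈ sa≢sb) (λ e → sa≢sb (trans sa≡sa₂ e)))
                               (m≤n+m (changes (a₂ ∷ r)) _)
    ... | no  sa≢sa₂ = ≤-trans (≤-reflexive (sym (change-≢ sa≢sa₂))) (m≤m+n _ (changes (a₂ ∷ r)))

    changes-≥2 : ∀ {a b z} r → b ∈ a ∷ r → s a ≢ s b → last (a ∷ r) ≡ just z → s z ≡ s a →
                 2 ≤ changes (a ∷ r)
    changes-≥2     []       b∈ sa≢sb _      _     = contradiction (∈-tail b∈ sa≢sb) λ ()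
    changes-≥2 {a} (a₂ ∷ r) b∈ sa≢sb last≡z sz≡sa with s a Bool.≟ s a₂
    ... | yes sa≡sa₂ =
      ≤-trans (changes-≥2 r (∈-tail b∈ sa≢sb) (λ e → sa≢sb (trans sa≡sa₂ e)) last≡z
                          (trans sz≡sa sa≡sa₂))
              (m≤n+m (changes (a₂ ∷ r)) _)
    ... | no  sa≢sa₂ =
      ≤-trans (s≤s (changes-≥1 r (last-∈ (a₂ ∷ r) last≡z)
                               (λ e → sa≢sa₂ (trans (sym sz≡sa) (sym e)))))
              (≤-reflexive (cong (_+ changes (a₂ ∷ r)) (sym (change-≢ sa≢sa₂))))

  isBelow : ℕ → ℕ → Bool
  isBelow j y = does (y <? j)

  compress : ℕ → ℕ → ℕ
  compress j y = if isBelow j y then y else pred y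

  data Side (j y : ℕ) : Set where
    below : y < j → Side j y
    above : j < y → Side j y

  side : ∀ {j y} → y ≢ j → Side j y
  side {j} {y} y≢j with <-cmp y j
  ... | tri< y<j _ _ = below y<j
  ... | tri≈ _ y≡j _ = contradiction y≡j y≢j
  ... | tri> _ _ j<y = above j<y

  isBelow-< : ∀ {j y} → y < j → isBelow j y ≡ true
  isBelow-< {j} {y} y<j = dec-true (y <? j) y<j

  isBelow-> : ∀ {j y} → j < y → isBelow j y ≡ false
  isBelow-> {j} {y} j<y = dec-false (y <? j) (<⇒≯ j<y)

  compress-< : ∀ {j y} → y < j → compress j y ≡ y
  compress-< y<j rewrite isBelow-< y<j = refl

  compress-> : ∀ {j y} → j < y → compress j y ≡ pred y
  compress-> j<y rewrite isBelow-> j<y = refl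

  compress-injective : ∀ {j a b} → a ≢ j → b ≢ j → compress j a ≡ compress j b → a ≡ b
  compress-injective a≢j b≢j eq with side a≢j | side b≢j
  ... | below a<j | below b<j = trans (sym (compress-< a<j)) (trans eq (compress-< b<j))
  ... | above j<a | above j<b =
    pred-injective {{>-nonZero (<-≤-trans z<s j<a)}} {{>-nonZero (<-≤-trans z<s j<b)}}
                   (trans (sym (compress-> j<a)) (trans eq (compress-> j<b)))
  ... | below a<j | above j<b =
    contradiction (trans (sym (compress-< a<j)) (trans eq (compress-> j<b)))
                  (<⇒≢ (<-≤-trans a<j (<⇒≤pred j<b)))
  ... | above j<a | below b<j =
    contradiction (trans (sym (compress-< b<j)) (trans (sym eq) (compress-> j<a)))
                  (<⇒≢ (<-≤-trans b<j (<⇒≤pred j<a)))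

  InRange : ℕ → ℕ → Set
  InRange n y = 1 ≤ y × y ≤ n

  compress-inRange : ∀ {m j y} → 1 ≤ j → j ≤ suc m → InRange (suc m) y → y ≢ j →
                     InRange m (compress j y)
  compress-inRange 1≤j j≤1+m (1≤y , y≤1+m) y≢j with side y≢j
  ... | below y<j rewrite compress-< y<j = 1≤y , ≤-pred (≤-trans y<j j≤1+m)
  ... | above j<y rewrite compress-> j<y = ≤-trans 1≤j (<⇒≤pred j<y) , pred-mono-≤ y≤1+m

  ∣m-n∣∸1≡pred[n]∸m : ∀ {m n} → m < n → ∣ m - n ∣ ∸ 1 ≡ pred n ∸ m
  ∣m-n∣∸1≡pred[n]∸m {m} {suc n} (s≤s m≤n) =
    cong (_∸ 1) (trans (m≤n⇒∣m-n∣≡n∸m (m≤n⇒m≤1+n m≤n)) (+-∸-assoc 1 m≤n))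

  private
    crossingCost : ∀ {a j b} → a < j → j < b → ∣ a - b ∣ ∸ 1 ≡ (∣ a - pred b ∣ ∸ 1) + 1
    crossingCost {a} {j} {b} a<j j<b = begin
      ∣ a - b ∣ ∸ 1              ≡⟨ ∣m-n∣∸1≡pred[n]∸m (<-trans a<j j<b) ⟩
      pred b ∸ a                 ≡⟨ m∸n+n≡m (m<n⇒0<n∸m a<pred[b]) ⟨
      (pred b ∸ a ∸ 1) + 1       ≡⟨ cong (λ d → d ∸ 1 + 1) (m≤n⇒∣m-n∣≡n∸m (<⇒≤ a<pred[b])) ⟨
      (∣ a - pred b ∣ ∸ 1) + 1   ∎
      where
      open ≡-Reasoning
      a<pred[b] = <-≤-trans a<j (<⇒≤pred j<b)

    ∣pred-pred∣ : ∀ {j a b} → j < a → j < b → ∣ a - b ∣ ≡ ∣ pred a - pred b ∣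
    ∣pred-pred∣ {a = suc a} {suc b} _ _ = refl

  edgeCost-compress : ∀ {j a b} → a ≢ j → b ≢ j →
    ∣ a - b ∣ ∸ 1 ≡ (∣ compress j a - compress j b ∣ ∸ 1) + (if isBelow j a xor isBelow j b then 1 else 0)
  edgeCost-compress {j} {a} {b} a≢j b≢j with side a≢j | side b≢j
  ... | below a<j | below b<j rewrite compress-< a<j | compress-< b<j | isBelow-< a<j | isBelow-< b<j =
    sym (+-identityʳ _)
  ... | above j<a | above j<b rewrite compress-> j<a | compress-> j<b | isBelow-> j<a | isBelow-> j<b =
    trans (cong (_∸ 1) (∣pred-pred∣ j<a j<b)) (sym (+-identityʳ _))
  ... | below a<j | above j<b rewrite compress-< a<j | compress-> j<b | isBelow-< a<j | isBelow-> j<b =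
    crossingCost a<j j<b
  ... | above j<a | below b<j rewrite compress-> j<a | compress-< b<j | isBelow-> j<a | isBelow-< b<j =
    trans (cong (_∸ 1) (∣-∣-comm a b))
          (trans (crossingCost b<j j<a) (cong (λ d → (d ∸ 1) + 1) (∣-∣-comm b (pred a))))

  netCost-compress : ∀ j l → All (_≢ j) l →
                     netCost l ≡ netCost (map (compress j) l) + changes (isBelow j) l
  netCost-compress j []          _ = refl
  netCost-compress j (a ∷ [])    _ = refl
  netCost-compress j (a ∷ b ∷ r) (a≢j ∷ b≢j ∷ r≢j) =
    trans (cong₂ _+_ (edgeCost-compress a≢j b≢j) (netCost-compress j (b ∷ r) (b≢j ∷ r≢j)))
          (interchange (∣ compress j a - compress j b ∣ ∸ 1) _ (netCost (map (compress j) (b ∷ r))) _)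

module Arrangements where

  open import Data.Nat.Base
  open import Data.Nat.Properties
  open import Data.Bool.Base using (if_then_else_)
  open import Data.Maybe.Base using (just; fromMaybe)
  import Data.Maybe.Base as Maybe
  open import Data.Product.Base using (_,_; proj₁; proj₂; ∃₂)
  open import Data.Fin.Base using (Fin; toℕ)
  import Data.Fin.Properties as Fin
  open import Data.Vec.Base using (toList)
  import Data.Vec.Properties as Vec
  open import Data.List.Base using (List; []; _∷_; map; length; head; last)
  open import Data.List.Properties using (length-map; last-map; map-injective)
  open import Data.List.Relation.Unary.All as All using (All; []; _∷_)
  import Data.List.Relation.Unary.All.Properties as All
  open import Data.List.Relation.Unary.Unique.Propositional using (Unique; []; _∷_)
  import Data.List.Relation.Unary.Unique.Propositional.Properties as Unique
  open import Data.List.Relation.Unary.Any using (here; there)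
  open import Data.List.Membership.Propositional using (_∈_)
  open import Data.List.Membership.DecPropositional _≟_ using (_∈?_)
  open import Function.Base using (_∘_)
  open import Relation.Binary.PropositionalEquality
  open import Relation.Nullary using (yes; no; contradiction)
  open import Relation.Nullary.Decidable using (dec-false)
  open import Defs using (netCost; Arrangement; positions; InOLA⁺)
  open Lists
  open Compression

  compress-unique : ∀ {j l} → All (_≢ j) l → Unique l → Unique (map (compress j) l)
  compress-unique {j} = Unique-map-injectiveOn (compress j) compress-injective

  compress-allInRange : ∀ {m j l} → 1 ≤ j → j ≤ suc m → All (_≢ j) l → All (InRange (suc m)) l →
                        All (InRange m) (map (compress j) l)
  compress-allInRange 1≤j j≤1+m l≢j l∈ =
    All.map⁺ (All.zipWith (λ (y≢j , y∈) → compress-inRange 1≤j j≤1+m y∈ y≢j) (l≢j , l∈))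

  unique⇒length≤ : ∀ n l → Unique l → All (InRange n) l → length l ≤ n
  unique⇒length≤ n       []      _         _                     = z≤n
  unique⇒length≤ zero    (x ∷ l) _         ((1≤x , x≤0) ∷ _)     = contradiction (≤-trans 1≤x x≤0) λ ()
  unique⇒length≤ (suc m) (x ∷ l) (x∉l ∷ u) ((1≤x , x≤1+m) ∷ l∈) =
    s≤s (subst (_≤ m) (length-map (compress x) l)
          (unique⇒length≤ m (map (compress x) l) (compress-unique l≢x u)
                          (compress-allInRange 1≤x x≤1+m l≢x l∈)))
    where l≢x = All.map ≢-sym x∉l

  unique-length≡⇒∈ : ∀ {n l y} → Unique l → All (InRange n) l → length l ≡ n →
                     InRange n y → y ∈ l
  unique-length≡⇒∈ {zero}  _ _ _ (1≤y , y≤0) = contradiction (≤-trans 1≤y y≤0) λ ()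
  unique-length≡⇒∈ {suc m} {l} {y} u l∈ len≡n (1≤y , y≤1+m) with y ∈? l
  ... | yes y∈l = y∈l
  ... | no  y∉l = contradiction
    (unique⇒length≤ m (map (compress y) l) (compress-unique (∉⇒All≢ y∉l) u)
                    (compress-allInRange 1≤y y≤1+m (∉⇒All≢ y∉l) l∈))
    (subst (_≰ m) (sym (trans (length-map (compress y) l) len≡n)) 1+n≰n)

  record IsArrangement (n j : ℕ) (l : List ℕ) : Set where
    field
      unique   : Unique l
      inRange  : All (InRange n) l
      length≡n : length l ≡ n
      head≡j   : head l ≡ just j
      last≡n   : last l ≡ just n
  open IsArrangement public

  shorten : List ℕ → List ℕ
  shorten []       = []
  shorten (j ∷ ys) = map (compress j) ys

  -- 0 on the empty list, which is never an arrangement.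
  firstVertex : List ℕ → ℕ
  firstVertex = fromMaybe 0 ∘ head

  shape : ∀ {m j l} → IsArrangement (2 + m) j l → ∃₂ λ h r → l ≡ j ∷ h ∷ r
  shape {l = []}        arr = contradiction (length≡n arr) λ ()
  shape {l = _ ∷ []}    arr = contradiction (length≡n arr) λ ()
  shape {l = _ ∷ h ∷ r} arr with refl ← head≡j arr = h , r , refl

  recrossings : ℕ → ℕ
  recrossings (suc (suc _)) = 2
  recrossings _             = 0

  recrossings≤ : ∀ j {c} → (2 ≤ j → 2 ≤ c) → recrossings j ≤ c
  recrossings≤ zero          _   = z≤n
  recrossings≤ (suc zero)    _   = z≤n
  recrossings≤ (suc (suc j)) 2≤c = 2≤c (s≤s (s≤s z≤n))

  -- A lower bound on the net cost lost by deleting a first vertex at position j whose neighbour is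
  -- renumbered κ.  For κ < j the first edge costs j − κ − 1 and the rest of the path crosses back over
  -- position j to reach n.  For κ ≥ j it costs κ − j, and if j ≥ 2 the rest of the path crosses j to
  -- reach position 1 and once more to return to n.
  deletionCost : ℕ → ℕ → ℕ
  deletionCost j κ = if isBelow j κ then j ∸ κ else recrossings j + (κ ∸ j)

  deletionCost-< : ∀ {j κ} → κ < j → deletionCost j κ ≡ j ∸ κ
  deletionCost-< κ<j rewrite isBelow-< κ<j = refl

  deletionCost-≥ : ∀ {j κ} → j ≤ κ → deletionCost j κ ≡ recrossings j + (κ ∸ j)
  deletionCost-≥ {j} {κ} j≤κ rewrite dec-false (κ <? j) (≤⇒≯ j≤κ) = refl

  module Shortening {m j h r} (arr : IsArrangement (2 + m) j (j ∷ h ∷ r)) where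
    open ≤-Reasoning

    ys≢j : All (_≢ j) (h ∷ r)
    ys≢j with j∉ys ∷ _ ← unique arr = All.map ≢-sym j∉ys

    j∈ : InRange (2 + m) j
    j∈ with j∈ ∷ _ ← inRange arr = j∈

    n∈ys : 2 + m ∈ h ∷ r
    n∈ys = last-∈ (h ∷ r) (last≡n arr)

    j<n : j < 2 + m
    j<n = ≤∧≢⇒< (proj₂ j∈) (λ j≡n → All.lookup ys≢j n∈ys (sym j≡n))

    shortened : IsArrangement (suc m) (compress j h) (map (compress j) (h ∷ r))
    shortened = record
      { unique   = compress-unique ys≢j (tail-unique (unique arr))
      ; inRange  = compress-allInRange (proj₁ j∈) (proj₂ j∈) ys≢j (tail-inRange (inRange arr))
      ; length≡n = trans (length-map (compress j) (h ∷ r)) (suc-injective (length≡n arr))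
      ; head≡j   = refl
      ; last≡n   = trans (last-map (compress j) (h ∷ r))
                         (trans (cong (Maybe.map (compress j)) (last≡n arr)) (cong just (compress-> j<n)))
      }
      where
      tail-unique : ∀ {x xs} → Unique (x ∷ xs) → Unique xs
      tail-unique (_ ∷ u) = u
      tail-inRange : ∀ {x xs} → All (InRange (2 + m)) (x ∷ xs) → All (InRange (2 + m)) xs
      tail-inRange (_ ∷ ps) = ps

    crossings : ℕ
    crossings = changes (isBelow j) (h ∷ r)

    deletionCost≤ : deletionCost j (compress j h) ≤ (∣ j - h ∣ ∸ 1) + crossings
    deletionCost≤ with side (All.lookup ys≢j (here refl))
    ... | below h<j rewrite compress-< h<j | deletionCost-< h<j | m≤n⇒∣n-m∣≡n∸m (<⇒≤ h<j) = begin
      j ∸ h                     ≡⟨ m∸n+n≡m (m<n⇒0<n∸m h<j) ⟨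
      (j ∸ h ∸ 1) + 1           ≤⟨ +-monoʳ-≤ (j ∸ h ∸ 1) crossing ⟩
      (j ∸ h ∸ 1) + crossings   ∎
      where
      crossing : 1 ≤ crossings
      crossing = changes-≥1 (isBelow j) r n∈ys λ below≡above →
        contradiction (trans (sym (isBelow-< h<j)) (trans below≡above (isBelow-> j<n))) λ ()
    ... | above j<h = begin
      deletionCost j (compress j h)   ≡⟨ cong (deletionCost j) (compress-> j<h) ⟩
      deletionCost j (pred h)         ≡⟨ deletionCost-≥ (<⇒≤pred j<h) ⟩
      recrossings j + (pred h ∸ j)    ≤⟨ +-monoˡ-≤ (pred h ∸ j) (recrossings≤ j recrossing) ⟩
      crossings + (pred h ∸ j)        ≡⟨ +-comm crossings (pred h ∸ j) ⟩
      (pred h ∸ j) + crossings        ≡⟨ cong (_+ crossings) (∣m-n∣∸1≡pred[n]∸m j<h) ⟨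
      (∣ j - h ∣ ∸ 1) + crossings     ∎
      where
      recrossing : 2 ≤ j → 2 ≤ crossings
      recrossing 2≤j = changes-≥2 (isBelow j) r 1∈ys
        (λ above≡below → contradiction (trans (sym (isBelow-> j<h)) (trans above≡below (isBelow-< 2≤j))) λ ())
        (last≡n arr) (trans (isBelow-> j<n) (sym (isBelow-> j<h)))
        where
        1∈ys : 1 ∈ h ∷ r
        1∈ys with unique-length≡⇒∈ (unique arr) (inRange arr) (length≡n arr) (≤-refl , s≤s z≤n)
        ... | here 1≡j  = contradiction 1≡j (<⇒≢ 2≤j)
        ... | there 1∈ys = 1∈ys

    shortened-cost : deletionCost j (compress j h) + netCost (map (compress j) (h ∷ r)) ≤ netCost (j ∷ h ∷ r)
    shortened-cost = begin
      deletionCost j (compress j h) + netCost ys′   ≤⟨ +-monoˡ-≤ (netCost ys′) deletionCost≤ ⟩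
      firstEdge + crossings + netCost ys′           ≡⟨ +-assoc firstEdge crossings (netCost ys′) ⟩
      firstEdge + (crossings + netCost ys′)         ≡⟨ cong (firstEdge +_) (+-comm crossings (netCost ys′)) ⟩
      firstEdge + (netCost ys′ + crossings)         ≡⟨ cong (firstEdge +_) (netCost-compress j (h ∷ r) ys≢j) ⟨
      netCost (j ∷ h ∷ r)                           ∎
      where
      firstEdge = ∣ j - h ∣ ∸ 1
      ys′ = map (compress j) (h ∷ r)

  first∈range : ∀ {n j l} → IsArrangement n j l → InRange n j
  first∈range arr = All.lookup (inRange arr) (head-∈ _ (head≡j arr))

  module _ {m j l} (arr : IsArrangement (2 + m) j l) where

    first<last : j < 2 + m
    first<last with _ , _ , refl ← shape arr = Shortening.j<n arr

    shorten-arrangement : IsArrangement (suc m) (firstVertex (shorten l)) (shorten l)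
    shorten-arrangement with _ , _ , refl ← shape arr = Shortening.shortened arr

    shorten-cost : deletionCost j (firstVertex (shorten l)) + netCost (shorten l) ≤ netCost l
    shorten-cost with _ , _ , refl ← shape arr = Shortening.shortened-cost arr

  shorten-injective : ∀ {m j l l′} → IsArrangement (2 + m) j l → IsArrangement (2 + m) j l′ →
                      shorten l ≡ shorten l′ → l ≡ l′
  shorten-injective {j = j} arr arr′ eq with _ , _ , refl ← shape arr | _ , _ , refl ← shape arr′ =
    cong (j ∷_) (map-injectiveOn (compress j) compress-injective
                   (Shortening.ys≢j arr) (Shortening.ys≢j arr′) eq)

  suc∘toℕ-injective : ∀ {n} {a b : Fin n} → suc (toℕ a) ≡ suc (toℕ b) → a ≡ b
  suc∘toℕ-injective = Fin.toℕ-injective ∘ suc-injective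

  positions-injective : ∀ {n} {v w : Arrangement n} → positions v ≡ positions w → v ≡ w
  positions-injective {v = v} {w} eq =
    trans (sym (Vec.cast-is-id refl v)) (Vec.toList-injective refl v w (map-injective suc∘toℕ-injective eq))

  InOLA⁺⇒IsArrangement : ∀ {n k j v} → InOLA⁺ n k j v → IsArrangement n j (positions v)
  InOLA⁺⇒IsArrangement {v = v} (unique , _ , (_ , starts) , (xs , ends)) = record
    { unique   = Unique.map⁺ suc∘toℕ-injective unique
    ; inRange  = All.map⁺ (All.universal (λ a → s≤s z≤n , Fin.toℕ<n a) (toList v))
    ; length≡n = trans (length-map _ (toList v)) (Vec.length-toList v)
    ; head≡j   = cong head starts
    ; last≡n   = trans (cong last ends) (last-++-singleton xs _)
    }

module Recurrence where

  open import Data.Nat.Base as ℕ using (ℕ; zero; suc; _∸_; z≤n; s≤s)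
  import Data.Nat.Properties as ℕ
  open import Data.Integer.Base using (+_)
  open import Data.Product.Base using (_,_)
  open import Data.List.Base using (List; _++_; applyUpTo)
  open import Data.List.Relation.Unary.All.Properties using (applyUpTo⁺₂)
  open import Data.List.Membership.Propositional using (_∈_)
  open import Data.List.Membership.Propositional.Properties using (∈-++⁺ˡ; ∈-++⁺ʳ; ∈-applyUpTo⁺)
  open import Data.Rational.Unnormalised.Base
  open import Data.Rational.Unnormalised.Properties
  open import Data.Rational.Unnormalised.Solver using (module +-*-Solver)
  open import Relation.Binary.PropositionalEquality using (_≡_; cong; sym; trans; subst)
  open import Relation.Nullary using (yes; no)
  open RationalSums
  open Compression using (InRange)
  open Arrangements using (deletionCost; deletionCost-<; deletionCost-≥)
  open +-*-Solver
  open ≤-Reasoning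

  -- x ≥ 2 ^ -1.96, ρ ≤ 2 ^ 0.119 and δ ≤ 2 ^ -0.967095 are the three bases of the statement, and
  -- y = x / δ ≈ 1 − d₂.  The recurrence is solved with the geometric series Σ yⁱ ≤ Gy and Σ zⁱ ≤ Gz.
  y δ ρ Gy Gz x z : ℚᵘ
  y  = + 251232499 / 500000000
  δ  = + 63941881 / 125000000
  ρ  = + 217196371 / 200000000
  Gy = + 2009908843 / 1000000000
  Gz = + 1151382723 / 1000000000
  x  = y * δ
  z  = x * δ

  0≤y : 0ℚᵘ ≤ y
  0≤y = ≤ᵇ⇒≤ _
  0≤δ : 0ℚᵘ ≤ δ
  0≤δ = ≤ᵇ⇒≤ _
  0≤ρ : 0ℚᵘ ≤ ρ
  0≤ρ = ≤ᵇ⇒≤ _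
  0≤Gy : 0ℚᵘ ≤ Gy
  0≤Gy = ≤ᵇ⇒≤ _
  0≤Gz : 0ℚᵘ ≤ Gz
  0≤Gz = ≤ᵇ⇒≤ _
  0≤x : 0ℚᵘ ≤ x
  0≤x = ≤ᵇ⇒≤ _
  0≤z : 0ℚᵘ ≤ z
  0≤z = ≤ᵇ⇒≤ _
  0≤x*x : 0ℚᵘ ≤ x * x
  0≤x*x = ≤ᵇ⇒≤ _
  0≤z*z : 0ℚᵘ ≤ z * z
  0≤z*z = ≤ᵇ⇒≤ _
  x≤1 : x ≤ 1ℚᵘ
  x≤1 = ≤ᵇ⇒≤ _
  x≤δ : x ≤ δ
  x≤δ = ≤ᵇ⇒≤ _
  Gy-geometric : 1ℚᵘ + y * Gy ≤ Gy
  Gy-geometric = ≤ᵇ⇒≤ _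
  Gz-geometric : 1ℚᵘ + z * Gz ≤ Gz
  Gz-geometric = ≤ᵇ⇒≤ _
  ρ-start₁ : 1ℚᵘ + x * x + z * z * Gz ≤ ρ
  ρ-start₁ = ≤ᵇ⇒≤ _
  ρ-start≥3 : y * Gy + x * x * Gz ≤ ρ
  ρ-start≥3 = ≤ᵇ⇒≤ _

  -- At κ = 2 the bound is x δ < δ²: the case j = 1 of the recurrence needs this, and it is the
  -- second claim of the theorem.
  decay : ℕ → ℚᵘ
  decay 2 = x * δ
  decay κ = δ ^ κ

  prefactor : ℕ → ℚᵘ
  prefactor n = + 4 / 1 * ρ ^ n

  bound : ℕ → ℕ → ℚᵘ
  bound n κ = prefactor n * decay κ

  decay≤δ^ : ∀ κ → decay κ ≤ δ ^ κ
  decay≤δ^ 0 = ≤-refl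
  decay≤δ^ 1 = ≤-refl
  decay≤δ^ 2 =
    *-monoˡ-≤-nonNeg δ {{nonNegative 0≤δ}} (≤-trans x≤δ (≤-reflexive (≃-sym (*-identityʳ δ))))
  decay≤δ^ (suc (suc (suc κ))) = ≤-refl

  0≤decay : ∀ κ → 0ℚᵘ ≤ decay κ
  0≤decay 2 = *-nonNeg 0≤x 0≤δ
  0≤decay 0 = ^-nonNeg 0 0≤δ
  0≤decay 1 = ^-nonNeg 1 0≤δ
  0≤decay (suc (suc (suc κ))) = ^-nonNeg (3 ℕ.+ κ) 0≤δ

  0≤prefactor : ∀ n → 0ℚᵘ ≤ prefactor n
  0≤prefactor n = *-nonNeg {+ 4 / 1} {ρ ^ n} (≤ᵇ⇒≤ _) (^-nonNeg n 0≤ρ)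

  0≤bound : ∀ n κ → 0ℚᵘ ≤ bound n κ
  0≤bound n κ = *-nonNeg {prefactor n} {decay κ} (0≤prefactor n) (0≤decay κ)

  bound≤ : ∀ n κ → bound n κ ≤ prefactor n * δ ^ κ
  bound≤ n κ = *-monoʳ-≤-0≤ (prefactor n) (0≤prefactor n) (decay≤δ^ κ)

  -- The candidates for the first vertex κ of the shortened arrangement, as κ = j − 1 − i and κ = j + t:
  -- in these parameters the terms of the recurrence decay geometrically.
  keys : ℕ → ℕ → List ℕ
  keys j m = applyUpTo (λ i → j ∸ suc i) (j ∸ 1) ++ applyUpTo (j ℕ.+_) (suc m ∸ j)

  recurrence : ℕ → ℕ → ℚᵘ
  recurrence m j = ∑[ κ ∈ keys j m ] x ^ deletionCost j κ * bound m κ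

  ^-split : ∀ p {m n} → m ℕ.≤ n → p ^ m * p ^ (n ∸ m) ≃ p ^ n
  ^-split p {m} {n} m≤n =
    ≃-trans (≃-sym (^-homo-* p m (n ∸ m))) (≃-reflexive (cong (p ^_) (ℕ.m+[n∸m]≡n m≤n)))

  belowTerm≤ : ∀ m j i → suc i ℕ.≤ j →
    x ^ deletionCost j (j ∸ suc i) * bound m (j ∸ suc i) ≤ prefactor m * δ ^ j * y * y ^ i
  belowTerm≤ m j i 1+i≤j = begin
    x ^ deletionCost j κ * bound m κ
      ≡⟨ cong (λ d → x ^ d * bound m κ) Δ≡1+i ⟩
    x ^ suc i * bound m κ
      ≤⟨ *-monoʳ-≤-0≤ (x ^ suc i) (^-nonNeg (suc i) 0≤x) (bound≤ m κ) ⟩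
    x ^ suc i * (prefactor m * δ ^ κ)
      ≃⟨ *-congʳ (^-distrib-* y δ (suc i)) ⟩
    y ^ suc i * δ ^ suc i * (prefactor m * δ ^ κ)
      ≃⟨ solve 4 (λ Y D P E → Y :* D :* (P :* E) := P :* (D :* E) :* Y) ≃-refl
           (y ^ suc i) (δ ^ suc i) (prefactor m) (δ ^ κ) ⟩
    prefactor m * (δ ^ suc i * δ ^ κ) * y ^ suc i
      ≃⟨ *-congʳ (*-congˡ {prefactor m} (^-split δ 1+i≤j)) ⟩
    prefactor m * δ ^ j * (y * y ^ i)
      ≃⟨ *-assoc (prefactor m * δ ^ j) y (y ^ i) ⟨
    prefactor m * δ ^ j * y * y ^ i ∎
    where
    κ = j ∸ suc i
    Δ≡1+i : deletionCost j κ ≡ suc i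
    Δ≡1+i = trans (deletionCost-< (ℕ.∸-monoʳ-< {j} ℕ.z<s 1+i≤j)) (ℕ.m∸[m∸n]≡n 1+i≤j)

  aboveTerm≤ : ∀ m j t → 2 ℕ.≤ j →
    x ^ deletionCost j (j ℕ.+ t) * bound m (j ℕ.+ t) ≤ prefactor m * δ ^ j * (x * x) * z ^ t
  aboveTerm≤ _ 1 _ (s≤s ())
  aboveTerm≤ m j@(suc (suc _)) t _ = begin
    x ^ deletionCost j (j ℕ.+ t) * bound m (j ℕ.+ t)
      ≡⟨ cong (λ d → x ^ d * bound m (j ℕ.+ t)) Δ≡2+t ⟩
    x * (x * x ^ t) * bound m (j ℕ.+ t)
      ≤⟨ *-monoʳ-≤-0≤ (x ^ (2 ℕ.+ t)) (^-nonNeg (2 ℕ.+ t) 0≤x) (bound≤ m (j ℕ.+ t)) ⟩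
    x * (x * x ^ t) * (prefactor m * δ ^ (j ℕ.+ t))
      ≃⟨ *-congˡ {x ^ (2 ℕ.+ t)} (*-congˡ {prefactor m} (^-homo-* δ j t)) ⟩
    x * (x * x ^ t) * (prefactor m * (δ ^ j * δ ^ t))
      ≃⟨ solve 5 (λ X Xt P Dj Dt → X :* (X :* Xt) :* (P :* (Dj :* Dt)) := P :* Dj :* (X :* X) :* (Xt :* Dt))
           ≃-refl x (x ^ t) (prefactor m) (δ ^ j) (δ ^ t) ⟩
    prefactor m * δ ^ j * (x * x) * (x ^ t * δ ^ t)
      ≃⟨ *-congˡ {prefactor m * δ ^ j * (x * x)} (^-distrib-* x δ t) ⟨
    prefactor m * δ ^ j * (x * x) * z ^ t ∎
    where
    Δ≡2+t : deletionCost j (j ℕ.+ t) ≡ 2 ℕ.+ t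
    Δ≡2+t = trans (deletionCost-≥ (ℕ.m≤m+n j t)) (cong (2 ℕ.+_) (ℕ.m+n∸m≡n j t))

  recurrence≤bound-≥3 : ∀ m j → 3 ℕ.≤ j → recurrence m j ≤ bound (suc m) j
  recurrence≤bound-≥3 _ 1 (s≤s ())
  recurrence≤bound-≥3 _ 2 (s≤s (s≤s ()))
  recurrence≤bound-≥3 m j@(suc (suc (suc _))) _ = begin
    recurrence m j
      ≃⟨ sum-++ F (applyUpTo (λ i → j ∸ suc i) (j ∸ 1)) (applyUpTo (j ℕ.+_) (suc m ∸ j)) ⟩
    ∑[ κ ∈ applyUpTo (λ i → j ∸ suc i) (j ∸ 1) ] F κ + ∑[ κ ∈ applyUpTo (j ℕ.+_) (suc m ∸ j) ] F κ
      ≤⟨ +-mono-≤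
           (sum-geometric 0≤y 0≤Gy Gy-geometric F (λ i → j ∸ suc i) (j ∸ 1) (*-nonNeg {C} {y} 0≤C 0≤y)
              (λ i i<j∸1 → belowTerm≤ m j i (ℕ.≤-trans i<j∸1 (ℕ.m∸n≤m j 1))))
           (sum-geometric 0≤z 0≤Gz Gz-geometric F (j ℕ.+_) (suc m ∸ j) (*-nonNeg {C} {x * x} 0≤C 0≤x*x)
              (λ t _ → aboveTerm≤ m j t (s≤s (s≤s z≤n)))) ⟩
    C * y * Gy + C * (x * x) * Gz
      ≃⟨ solve 5 (λ C y x Gy Gz → C :* y :* Gy :+ C :* (x :* x) :* Gz := C :* (y :* Gy :+ x :* x :* Gz))
           ≃-refl C y x Gy Gz ⟩
    C * (y * Gy + x * x * Gz)
      ≤⟨ *-monoʳ-≤-0≤ C 0≤C ρ-start≥3 ⟩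
    C * ρ
      ≃⟨ solve 4 (λ F r R D → F :* R :* D :* r := F :* (r :* R) :* D) ≃-refl (+ 4 / 1) ρ (ρ ^ m) (δ ^ j) ⟩
    bound (suc m) j ∎
    where
    F : ℕ → ℚᵘ
    F κ = x ^ deletionCost j κ * bound m κ
    C = prefactor m * δ ^ j
    0≤C : 0ℚᵘ ≤ C
    0≤C = *-nonNeg {prefactor m} {δ ^ j} (0≤prefactor m) (^-nonNeg j 0≤δ)

  recurrence≤bound-1 : ∀ m → 1 ℕ.≤ m → recurrence m 1 ≤ bound (suc m) 1
  recurrence≤bound-1 m@(suc m′) _ = begin
    F 1 + ∑[ κ ∈ applyUpTo (λ i → 2 ℕ.+ i) m′ ] F κ
      ≤⟨ +-monoʳ-≤ (F 1) (tail≤ m′) ⟩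
    1ℚᵘ * bound m 1 + A * (x * x + z * z * Gz)
      ≃⟨ solve 4 (λ A x z G → con 1ℚᵘ :* A :+ A :* (x :* x :+ z :* z :* G)
                            := A :* (con 1ℚᵘ :+ x :* x :+ z :* z :* G)) ≃-refl A x z Gz ⟩
    A * (1ℚᵘ + x * x + z * z * Gz)
      ≤⟨ *-monoʳ-≤-0≤ A 0≤A ρ-start₁ ⟩
    A * ρ
      ≃⟨ solve 4 (λ F r R D → F :* R :* D :* r := F :* (r :* R) :* D) ≃-refl (+ 4 / 1) ρ (ρ ^ m) (δ ^ 1) ⟩
    bound (suc m) 1 ∎
    where
    F : ℕ → ℚᵘ
    F κ = x ^ deletionCost 1 κ * bound m κ
    A = prefactor m * δ ^ 1
    0≤A : 0ℚᵘ ≤ A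
    0≤A = *-nonNeg {prefactor m} {δ ^ 1} (0≤prefactor m) (^-nonNeg 1 0≤δ)
    tail≤ : ∀ c → ∑[ κ ∈ applyUpTo (λ i → 2 ℕ.+ i) c ] F κ ≤ A * (x * x + z * z * Gz)
    tail≤ zero    =
      *-nonNeg {A} {x * x + z * z * Gz} 0≤A (+-nonNeg {x * x} 0≤x*x (*-nonNeg {z * z} {Gz} 0≤z*z 0≤Gz))
    tail≤ (suc c) = begin
      F 2 + ∑[ κ ∈ applyUpTo (λ i → 3 ℕ.+ i) c ] F κ
        ≤⟨ +-mono-≤ (≤-reflexive F2≃)
                    (sum-geometric 0≤z 0≤Gz Gz-geometric F (λ i → 3 ℕ.+ i) c 0≤A*z*z F≤) ⟩
      A * (x * x) + A * (z * z) * Gz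
        ≃⟨ solve 4 (λ A x z G → A :* (x :* x) :+ A :* (z :* z) :* G := A :* (x :* x :+ z :* z :* G))
             ≃-refl A x z Gz ⟩
      A * (x * x + z * z * Gz) ∎
      where
      F2≃ : F 2 ≃ A * (x * x)
      F2≃ = solve 4 (λ x d P o → x :* o :* (P :* (x :* d)) := P :* (d :* o) :* (x :* x))
              ≃-refl x δ (prefactor m) 1ℚᵘ
      0≤A*z*z = *-nonNeg {A} {z * z} 0≤A 0≤z*z
      F≤ : ∀ t → t ℕ.< c → F (3 ℕ.+ t) ≤ A * (z * z) * z ^ t
      F≤ t _ = ≤-trans (aboveTerm≤ m 3 t (s≤s (s≤s z≤n))) (≤-reflexive (*-congʳ
        (solve 4 (λ P d x o → P :* (d :* (d :* (d :* o))) :* (x :* x) := P :* (d :* o) :* ((x :* d) :* (x :* d)))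
           ≃-refl (prefactor m) δ x 1ℚᵘ)))

  recurrence-2≃x*recurrence-1 : ∀ m → 1 ℕ.≤ m → recurrence m 2 ≃ x * recurrence m 1
  recurrence-2≃x*recurrence-1 m@(suc m′) _ = begin-equality
    x ^ 1 * bound m 1 + ∑[ κ ∈ K ] x ^ deletionCost 2 κ * bound m κ
      ≃⟨ +-cong (solve 2 (λ x B → x :* con 1ℚᵘ :* B := x :* (con 1ℚᵘ :* B)) ≃-refl x (bound m 1))
                (sum-cong (applyUpTo⁺₂ (λ i → 2 ℕ.+ i) m′
                             (λ i → *-assoc x (x ^ suc i) (bound m (2 ℕ.+ i))))) ⟩
    x * F₁ 1 + ∑[ κ ∈ K ] x * F₁ κ    ≃⟨ +-congʳ (x * F₁ 1) (sum-*ˡ x F₁ K) ⟩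
    x * F₁ 1 + x * (∑[ κ ∈ K ] F₁ κ)  ≃⟨ *-distribˡ-+ x (F₁ 1) (∑[ κ ∈ K ] F₁ κ) ⟨
    x * recurrence m 1                ∎
    where
    K = applyUpTo (λ i → 2 ℕ.+ i) m′
    F₁ : ℕ → ℚᵘ
    F₁ κ = x ^ deletionCost 1 κ * bound m κ

  recurrence≤bound : ∀ m j → 1 ℕ.≤ j → j ℕ.≤ m → recurrence m j ≤ bound (suc m) j
  recurrence≤bound m 1 _ 1≤m = recurrence≤bound-1 m 1≤m
  recurrence≤bound m 2 _ 2≤m = begin
    recurrence m 2        ≃⟨ recurrence-2≃x*recurrence-1 m 1≤m ⟩
    x * recurrence m 1    ≤⟨ *-monoʳ-≤-0≤ x 0≤x (recurrence≤bound-1 m 1≤m) ⟩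
    x * bound (suc m) 1   ≃⟨ solve 3 (λ x P d → x :* (P :* (d :* con 1ℚᵘ)) := P :* (x :* d))
                                   ≃-refl x (prefactor (suc m)) δ ⟩
    bound (suc m) 2       ∎
    where 1≤m = ℕ.≤-trans (s≤s z≤n) 2≤m
  recurrence≤bound m (suc (suc (suc j))) _ _ = recurrence≤bound-≥3 m (3 ℕ.+ j) (s≤s (s≤s (s≤s z≤n)))

  keys-cover : ∀ {j m κ} → InRange m κ → κ ∈ keys j m
  keys-cover {j} {m} {κ} (1≤κ , κ≤m) with κ ℕ.<? j
  ... | yes κ<j = ∈-++⁺ˡ (subst (_∈ applyUpTo (λ i → j ∸ suc i) (j ∸ 1)) (below-index κ<j)
                              (∈-applyUpTo⁺ (λ i → j ∸ suc i) (below-index< κ<j)))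
    where
    below-index : ∀ {j} → κ ℕ.< j → j ∸ suc (j ∸ suc κ) ≡ κ
    below-index {suc j₀} (s≤s κ≤j₀) = ℕ.m∸[m∸n]≡n κ≤j₀
    below-index< : ∀ {j} → κ ℕ.< j → j ∸ suc κ ℕ.< j ∸ 1
    below-index< {suc j₀} (s≤s κ≤j₀) = ℕ.∸-monoʳ-< {j₀} {κ} {0} 1≤κ κ≤j₀
  ... | no  κ≮j = ∈-++⁺ʳ (applyUpTo (λ i → j ∸ suc i) (j ∸ 1))
                         (subst (_∈ applyUpTo (j ℕ.+_) (suc m ∸ j)) (ℕ.m+[n∸m]≡n j≤κ)
                                (∈-applyUpTo⁺ (j ℕ.+_) above-index<))
    where
    j≤κ = ℕ.≮⇒≥ κ≮j
    above-index< : κ ∸ j ℕ.< suc m ∸ j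
    above-index< =
      subst (κ ∸ j ℕ.<_) (sym (ℕ.+-∸-assoc 1 (ℕ.≤-trans j≤κ κ≤m))) (s≤s (ℕ.∸-monoˡ-≤ j κ≤m))

module WeightedCount where

  open import Data.Nat.Base as ℕ using (ℕ; zero; suc)
  import Data.Nat.Properties as ℕ
  open import Data.Product.Base using (_,_; _×_; proj₁)
  open import Data.List.Base using (List; []; _∷_; map)
  open import Data.List.Relation.Unary.All as All using (All; []; _∷_)
  import Data.List.Relation.Unary.All.Properties as All
  open import Data.List.Relation.Unary.Unique.Propositional using (Unique; _∷_)
  import Data.List.Relation.Unary.Unique.Propositional.Properties as Unique
  open import Data.Rational.Unnormalised.Base
  open import Data.Rational.Unnormalised.Properties
  open import Function.Base using (_∘_)
  open import Relation.Binary.PropositionalEquality using (_≡_; refl; subst; sym; trans)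
  open import Relation.Nullary using (contradiction)
  open import Defs using (netCost)
  open Lists using (Unique-map-injectiveOn)
  open RationalSums
  open Arrangements
  open Recurrence
  open ≤-Reasoning

  sum-^-shift : ∀ {A B : Set} {p} → 0ℚᵘ ≤ p → p ≤ 1ℚᵘ →
                (c : A → ℕ) (c′ : B → ℕ) (f : A → B) →
                ∀ Δ L → All (λ a → Δ ℕ.+ c′ (f a) ℕ.≤ c a) L →
                ∑[ a ∈ L ] p ^ c a ≤ p ^ Δ * (∑[ b ∈ map f L ] p ^ c′ b)
  sum-^-shift {p = p} 0≤p p≤1 c c′ f Δ []      []       = ≤-reflexive (≃-sym (*-zeroʳ (p ^ Δ)))
  sum-^-shift {p = p} 0≤p p≤1 c c′ f Δ (a ∷ L) (le ∷ les) = begin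
    p ^ c a + ∑[ b ∈ L ] p ^ c b
      ≤⟨ +-mono-≤ (^-antimonoʳ-≤ 0≤p p≤1 le) (sum-^-shift 0≤p p≤1 c c′ f Δ L les) ⟩
    p ^ (Δ ℕ.+ c′ (f a)) + p ^ Δ * (∑[ b ∈ map f L ] p ^ c′ b)
      ≃⟨ +-congˡ (p ^ Δ * (∑[ b ∈ map f L ] p ^ c′ b)) (^-homo-* p Δ (c′ (f a))) ⟩
    p ^ Δ * p ^ c′ (f a) + p ^ Δ * (∑[ b ∈ map f L ] p ^ c′ b)
      ≃⟨ *-distribˡ-+ (p ^ Δ) (p ^ c′ (f a)) (∑[ b ∈ map f L ] p ^ c′ b) ⟨
    p ^ Δ * (∑[ b ∈ map f (a ∷ L) ] p ^ c′ b) ∎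

  singleton-arrangement : ∀ {j l} → IsArrangement 1 j l → l ≡ 1 ∷ [] × j ≡ 1
  singleton-arrangement {l = []}        arr = contradiction (length≡n arr) λ ()
  singleton-arrangement {l = _ ∷ _ ∷ _} arr = contradiction (length≡n arr) λ ()
  singleton-arrangement {l = a ∷ []}    arr with refl ← head≡j arr | (1≤a , a≤1) ∷ [] ← inRange arr
    with refl ← ℕ.≤-antisym a≤1 1≤a = refl , refl

  weightedCount≤bound : ∀ m j L → Unique L → All (IsArrangement (suc m) j) L →
                        ∑[ l ∈ L ] x ^ netCost l ≤ bound (suc m) j
  weightedCount≤bound m       j []           _                _                = 0≤bound (suc m) j
  weightedCount≤bound zero    j (l ∷ [])     _                (arr ∷ [])
    with refl , refl ← singleton-arrangement arr = ≤ᵇ⇒≤ _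
  weightedCount≤bound zero    j (l ∷ l′ ∷ _) ((l≢l′ ∷ _) ∷ _) (arr ∷ arr′ ∷ _) =
    contradiction (trans (proj₁ (singleton-arrangement arr)) (sym (proj₁ (singleton-arrangement arr′)))) l≢l′
  weightedCount≤bound (suc m) j L@(_ ∷ _)    u                arrs@(arr ∷ _)   = begin
    ∑[ l ∈ L ] x ^ netCost l
      ≤⟨ sum≤sum-fibres key (λ l → x ^ netCost l) (λ l → ^-nonNeg (netCost l) 0≤x) (keys j (suc m)) L
           (All.map (λ arr → keys-cover {j} (first∈range (shorten-arrangement arr))) arrs) ⟩
    ∑[ κ ∈ keys j (suc m) ] ∑[ l ∈ fibre key κ L ] x ^ netCost l
      ≤⟨ sum-mono fibre≤ (keys j (suc m)) ⟩
    recurrence (suc m) j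
      ≤⟨ recurrence≤bound (suc m) j (proj₁ (first∈range arr)) (ℕ.≤-pred (first<last arr)) ⟩
    bound (suc (suc m)) j ∎
    where
    key : List ℕ → ℕ
    key = firstVertex ∘ shorten
    fibre≤ : ∀ κ → ∑[ l ∈ fibre key κ L ] x ^ netCost l ≤ x ^ deletionCost j κ * bound (suc m) κ
    fibre≤ κ = begin
      ∑[ l ∈ P ] x ^ netCost l
        ≤⟨ sum-^-shift 0≤x x≤1 netCost netCost shorten (deletionCost j κ) P (All.map costs arrs&keys) ⟩
      x ^ deletionCost j κ * (∑[ l ∈ map shorten P ] x ^ netCost l)
        ≤⟨ *-monoʳ-≤-0≤ (x ^ deletionCost j κ) (^-nonNeg (deletionCost j κ) 0≤x)
             (weightedCount≤bound m κ (map shorten P) unique′ (All.map⁺ (All.map shortened arrs&keys))) ⟩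
      x ^ deletionCost j κ * bound (suc m) κ ∎
      where
      P = fibre key κ L
      key≟κ = λ l → key l ℕ.≟ κ
      arrs&keys : All (λ l → IsArrangement (2 ℕ.+ m) j l × key l ≡ κ) P
      arrs&keys = All.zip (All.filter⁺ key≟κ arrs , All.all-filter key≟κ L)
      costs : ∀ {l} → IsArrangement (2 ℕ.+ m) j l × key l ≡ κ →
              deletionCost j κ ℕ.+ netCost (shorten l) ℕ.≤ netCost l
      costs (arr , refl) = shorten-cost arr
      shortened : ∀ {l} → IsArrangement (2 ℕ.+ m) j l × key l ≡ κ → IsArrangement (suc m) κ (shorten l)
      shortened (arr , refl) = shorten-arrangement arr
      unique′ : Unique (map shorten P)
      unique′ = Unique-map-injectiveOn shorten shorten-injective
                  (All.filter⁺ key≟κ arrs) (Unique.filter⁺ key≟κ u)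

module ClearingDenominators where

  open import Data.Nat.Base as ℕ using (ℕ; zero; suc)
  open import Data.Product.Base using (_,_)
  open import Data.Integer.Base as ℤ using (+_; -[1+_])
  import Data.Integer.Properties as ℤ
  open import Data.List.Base using (List; []; _∷_; map; length)
  open import Data.List.Relation.Unary.All as All using (All; []; _∷_)
  import Data.List.Relation.Unary.All.Properties as All
  open import Data.List.Relation.Unary.Unique.Propositional using (Unique)
  import Data.List.Relation.Unary.Unique.Propositional.Properties as Unique
  open import Data.Rational.Unnormalised.Base
  open import Data.Rational.Unnormalised.Properties
  open import Function.Base using (_∘_)
  open import Relation.Binary.PropositionalEquality using (_≡_; refl; cong; cong₂; trans; subst; subst₂; sym)
  open import Relation.Nullary using (contradiction)
  open import Defs using (Arrangement; InOLA⁺; netCost; positions)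
  open RationalSums
  open Arrangements using (InOLA⁺⇒IsArrangement; positions-injective)
  open Recurrence
  open WeightedCount using (weightedCount≤bound)
  open ≤-Reasoning

  num : ℚᵘ → ℕ
  num p = ℤ.∣ ↥ p ∣

  den : ℚᵘ → ℕ
  den p = ↧ₙ p

  num-* : ∀ p q → num (p * q) ≡ num p ℕ.* num q
  num-* (mkℚᵘ a _) (mkℚᵘ b _) = ℤ.abs-* a b

  den-* : ∀ p q → den (p * q) ≡ den p ℕ.* den q
  den-* (mkℚᵘ _ _) (mkℚᵘ _ _) = refl

  num-^ : ∀ p n → num (p ^ n) ≡ num p ℕ.^ n
  num-^ p zero    = refl
  num-^ p (suc n) = trans (num-* p (p ^ n)) (cong (num p ℕ.*_) (num-^ p n))

  den-^ : ∀ p n → den (p ^ n) ≡ den p ℕ.^ n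
  den-^ p zero    = refl
  den-^ p (suc n) = trans (den-* p (p ^ n)) (cong (den p ℕ.*_) (den-^ p n))

  ≤⇒num*den≤ : ∀ {p q} → 0ℚᵘ ≤ p → 0ℚᵘ ≤ q → p ≤ q →
               num p ℕ.* den q ℕ.≤ num q ℕ.* den p
  ≤⇒num*den≤ {mkℚᵘ (+ a) _} {mkℚᵘ (+ b) _} _ _ (*≤* a*d≤b*c) =
    ℤ.drop‿+≤+ (subst₂ ℤ._≤_ (sym (ℤ.pos-* a _)) (sym (ℤ.pos-* b _)) a*d≤b*c)
  ≤⇒num*den≤ {mkℚᵘ -[1+ _ ] _} 0≤p _ _ = contradiction (nonNegative 0≤p) λ ()
  ≤⇒num*den≤ {mkℚᵘ (+ _) _} {mkℚᵘ -[1+ _ ] _} _ 0≤q _ = contradiction (nonNegative 0≤q) λ ()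

  count : ∀ {A : Set} → List A → ℚᵘ
  count L = ∑[ _ ∈ L ] 1ℚᵘ

  count≡ : ∀ {A : Set} (L : List A) → count L ≡ mkℚᵘ (+ length L) 0
  count≡ []      = refl
  count≡ (a ∷ L) rewrite count≡ L = cong (λ i → mkℚᵘ (+ 1 ℤ.+ i) 0) (ℤ.*-identityʳ (+ length L))

  count*^≤sum : ∀ {A : Set} {p} → 0ℚᵘ ≤ p → p ≤ 1ℚᵘ → (c : A → ℕ) → ∀ k L →
                All (λ a → c a ℕ.≤ k) L → count L * p ^ k ≤ ∑[ a ∈ L ] p ^ c a
  count*^≤sum {p = p} 0≤p p≤1 c k []      []          = ≤-reflexive (*-zeroˡ (p ^ k))
  count*^≤sum {p = p} 0≤p p≤1 c k (a ∷ L) (ca≤k ∷ cL≤k) = begin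
    (1ℚᵘ + count L) * p ^ k
      ≃⟨ *-distribʳ-+ (p ^ k) 1ℚᵘ (count L) ⟩
    1ℚᵘ * p ^ k + count L * p ^ k
      ≤⟨ +-mono-≤ (≤-trans (≤-reflexive (*-identityˡ (p ^ k))) (^-antimonoʳ-≤ 0≤p p≤1 ca≤k))
                  (count*^≤sum 0≤p p≤1 c k L cL≤k) ⟩
    p ^ c a + ∑[ b ∈ L ] p ^ c b ∎

  count*x^k≤bound : ∀ {m k j} (L : List (Arrangement (suc m))) → Unique L → All (InOLA⁺ (suc m) k j) L →
                    count L * x ^ k ≤ bound (suc m) j
  count*x^k≤bound {m} {k} {j} L unique members = ≤-trans
    (count*^≤sum 0≤x x≤1 (netCost ∘ positions) k L (All.map (λ (_ , cost≤k , _) → cost≤k) members))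
    (subst (_≤ bound (suc m) j) (sum-map (λ l → x ^ netCost l) positions L)
       (weightedCount≤bound m j (map positions L) (Unique.map⁺ positions-injective unique)
          (All.map⁺ (All.map InOLA⁺⇒IsArrangement members))))

  cross-multiply : ∀ {A : Set} (L : List A) k n r → 0ℚᵘ ≤ r → count L * x ^ k ≤ prefactor n * r →
                   (length L ℕ.* num x ℕ.^ k) ℕ.* ((1 ℕ.* den ρ ℕ.^ n) ℕ.* den r)
                     ℕ.≤ ((4 ℕ.* num ρ ℕ.^ n) ℕ.* num r) ℕ.* (1 ℕ.* den x ℕ.^ k)
  cross-multiply L k n r 0≤r le =
    subst₂ ℕ._≤_ (cong₂ ℕ._*_ numˡ denʳ) (cong₂ ℕ._*_ numʳ denˡ) (≤⇒num*den≤ 0≤lhs 0≤rhs le)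
    where
    numˡ : num (count L * x ^ k) ≡ length L ℕ.* num x ℕ.^ k
    numˡ = trans (num-* (count L) (x ^ k)) (cong₂ ℕ._*_ (cong num (count≡ L)) (num-^ x k))
    denˡ : den (count L * x ^ k) ≡ 1 ℕ.* den x ℕ.^ k
    denˡ = trans (den-* (count L) (x ^ k)) (cong₂ ℕ._*_ (cong den (count≡ L)) (den-^ x k))
    numʳ : num (prefactor n * r) ≡ (4 ℕ.* num ρ ℕ.^ n) ℕ.* num r
    numʳ = trans (num-* (prefactor n) r)
                 (cong (ℕ._* num r) (trans (num-* (+ 4 / 1) (ρ ^ n)) (cong (4 ℕ.*_) (num-^ ρ n))))
    denʳ : den (prefactor n * r) ≡ (1 ℕ.* den ρ ℕ.^ n) ℕ.* den r
    denʳ = trans (den-* (prefactor n) r)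
                 (cong (ℕ._* den r) (trans (den-* (+ 4 / 1) (ρ ^ n)) (cong (1 ℕ.*_) (den-^ ρ n))))
    0≤lhs = *-nonNeg {count L} {x ^ k} (sum-nonNeg (λ _ → 1ℚᵘ) (λ _ → ≤ᵇ⇒≤ _) L) (^-nonNeg k 0≤x)
    0≤rhs = *-nonNeg {prefactor n} {r} (0≤prefactor n) 0≤r

  count-bound : ∀ {m k j} (L : List (Arrangement (suc m))) → Unique L → All (InOLA⁺ (suc m) k j) L →
    (length L ℕ.* num x ℕ.^ k) ℕ.* ((1 ℕ.* den ρ ℕ.^ suc m) ℕ.* den δ ℕ.^ j)
      ℕ.≤ ((4 ℕ.* num ρ ℕ.^ suc m) ℕ.* num δ ℕ.^ j) ℕ.* (1 ℕ.* den x ℕ.^ k)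
  count-bound {m} {k} {j} L unique members =
    subst₂ (λ a b → (length L ℕ.* num x ℕ.^ k) ℕ.* ((1 ℕ.* den ρ ℕ.^ suc m) ℕ.* a)
                      ℕ.≤ ((4 ℕ.* num ρ ℕ.^ suc m) ℕ.* b) ℕ.* (1 ℕ.* den x ℕ.^ k))
      (den-^ δ j) (num-^ δ j)
      (cross-multiply L k (suc m) (δ ^ j) (^-nonNeg j 0≤δ)
         (≤-trans (count*x^k≤bound L unique members) (bound≤ (suc m) j)))

  count-bound-at-2 : ∀ {m k} (L : List (Arrangement (suc m))) → Unique L → All (InOLA⁺ (suc m) k 2) L →
    (length L ℕ.* num x ℕ.^ k) ℕ.* ((1 ℕ.* den ρ ℕ.^ suc m) ℕ.* (den x ℕ.* den δ))
      ℕ.≤ ((4 ℕ.* num ρ ℕ.^ suc m) ℕ.* (num x ℕ.* num δ)) ℕ.* (1 ℕ.* den x ℕ.^ k)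
  count-bound-at-2 {m} {k} L unique members =
    cross-multiply L k (suc m) (x * δ) (*-nonNeg {x} {δ} 0≤x 0≤δ) (count*x^k≤bound L unique members)

module Log₂Bounds where

  open import Data.Nat.Base
  open import Data.Nat.Properties
  open import Data.Nat.Binary.Base as ℕᵇ using (ℕᵇ; 2[1+_]; 1+[2_])
  import Data.Nat.Binary.Properties as ℕᵇ
  open import Data.Bool.Base using (T)
  open import Relation.Binary.PropositionalEquality
  open import Algebra.Properties.CommutativeSemigroup *-commutativeSemigroup
    using (interchange; xy∙z≈xz∙y; xy∙z≈zy∙x)

  ^-distribʳ-* : ∀ m n o → (m * n) ^ o ≡ m ^ o * n ^ o
  ^-distribʳ-* m n zero    = refl
  ^-distribʳ-* m n (suc o) = begin
    m * n * (m * n) ^ o       ≡⟨ cong (m * n *_) (^-distribʳ-* m n o) ⟩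
    m * n * (m ^ o * n ^ o)   ≡⟨ interchange m n (m ^ o) (n ^ o) ⟩
    m * m ^ o * (n * n ^ o)   ∎
    where open ≡-Reasoning

  -- log₂ (p / q) ≤ (a − b) / d, stated without division or subtraction.
  record Log₂≤ (d p q a b : ℕ) : Set where
    constructor log₂≤
    field cleared : p ^ d * 2 ^ b ≤ q ^ d * 2 ^ a

  log₂≤-* : ∀ {d p q a b p′ q′ a′ b′} → Log₂≤ d p q a b → Log₂≤ d p′ q′ a′ b′ →
            Log₂≤ d (p * p′) (q * q′) (a + a′) (b + b′)
  log₂≤-* {d} {p} {q} {a} {b} {p′} {q′} {a′} {b′} (log₂≤ pq) (log₂≤ pq′) = log₂≤ (begin
    (p * p′) ^ d * 2 ^ (b + b′)         ≡⟨ cong₂ _*_ (^-distribʳ-* p p′ d) (^-distribˡ-+-* 2 b b′) ⟩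
    p ^ d * p′ ^ d * (2 ^ b * 2 ^ b′)   ≡⟨ interchange (p ^ d) (p′ ^ d) (2 ^ b) (2 ^ b′) ⟩
    p ^ d * 2 ^ b * (p′ ^ d * 2 ^ b′)   ≤⟨ *-mono-≤ pq pq′ ⟩
    q ^ d * 2 ^ a * (q′ ^ d * 2 ^ a′)   ≡⟨ interchange (q ^ d) (2 ^ a) (q′ ^ d) (2 ^ a′) ⟩
    q ^ d * q′ ^ d * (2 ^ a * 2 ^ a′)   ≡⟨ cong₂ _*_ (^-distribʳ-* q q′ d) (^-distribˡ-+-* 2 a a′) ⟨
    (q * q′) ^ d * 2 ^ (a + a′)         ∎)
    where open ≤-Reasoning

  log₂≤-^ : ∀ {d p q a b} → Log₂≤ d p q a b → ∀ k → Log₂≤ d (p ^ k) (q ^ k) (a * k) (b * k)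
  log₂≤-^ {d} {p} {q} {a} {b} pq k = subst₂ (Log₂≤ d (p ^ k) (q ^ k)) (*-comm k a) (*-comm k b) (go k)
    where
    go : ∀ k → Log₂≤ d (p ^ k) (q ^ k) (k * a) (k * b)
    go zero    = log₂≤ ≤-refl
    go (suc k) = log₂≤-* pq (go k)

  log₂≤-raise : ∀ {d p q a b} → Log₂≤ d p q a b → ∀ s → Log₂≤ (d * s) p q (a * s) (b * s)
  log₂≤-raise {d} {p} {q} {a} {b} (log₂≤ pq) s = log₂≤ (begin
    p ^ (d * s) * 2 ^ (b * s)   ≡⟨ cong₂ _*_ (^-*-assoc p d s) (^-*-assoc 2 b s) ⟨
    (p ^ d) ^ s * (2 ^ b) ^ s   ≡⟨ ^-distribʳ-* (p ^ d) (2 ^ b) s ⟨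
    (p ^ d * 2 ^ b) ^ s         ≤⟨ ^-monoˡ-≤ s pq ⟩
    (q ^ d * 2 ^ a) ^ s         ≡⟨ ^-distribʳ-* (q ^ d) (2 ^ a) s ⟩
    (q ^ d) ^ s * (2 ^ a) ^ s   ≡⟨ cong₂ _*_ (^-*-assoc q d s) (^-*-assoc 2 a s) ⟩
    q ^ (d * s) * 2 ^ (a * s)   ∎)
    where open ≤-Reasoning

  log₂≤-cancel : ∀ {d p q a b p′ q′} → Log₂≤ d p q a b → .{{NonZero q}} → p′ * q ≤ p * q′ →
                 Log₂≤ d p′ q′ a b
  log₂≤-cancel {d} {p} {q} {a} {b} {p′} {q′} (log₂≤ pq) p′q≤pq′ =
    log₂≤ (*-cancelʳ-≤ (p′ ^ d * 2 ^ b) (q′ ^ d * 2 ^ a) (q ^ d) {{m^n≢0 q d}} (begin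
      p′ ^ d * 2 ^ b * q ^ d    ≡⟨ xy∙z≈xz∙y (p′ ^ d) (2 ^ b) (q ^ d) ⟩
      p′ ^ d * q ^ d * 2 ^ b    ≡⟨ cong (_* 2 ^ b) (^-distribʳ-* p′ q d) ⟨
      (p′ * q) ^ d * 2 ^ b      ≤⟨ *-monoˡ-≤ (2 ^ b) (^-monoˡ-≤ d p′q≤pq′) ⟩
      (p * q′) ^ d * 2 ^ b      ≡⟨ cong (_* 2 ^ b) (^-distribʳ-* p q′ d) ⟩
      p ^ d * q′ ^ d * 2 ^ b    ≡⟨ xy∙z≈xz∙y (p ^ d) (q′ ^ d) (2 ^ b) ⟩
      p ^ d * 2 ^ b * q′ ^ d    ≤⟨ *-monoˡ-≤ (q′ ^ d) pq ⟩
      q ^ d * 2 ^ a * q′ ^ d    ≡⟨ xy∙z≈zy∙x (q ^ d) (2 ^ a) (q′ ^ d) ⟩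
      q′ ^ d * 2 ^ a * q ^ d    ∎))
    where open ≤-Reasoning

  log₂≤-4 : ∀ d → Log₂≤ d 4 1 (2 * d) 0
  log₂≤-4 d = log₂≤ (≤-reflexive (begin
    4 ^ d * 1             ≡⟨ *-identityʳ (4 ^ d) ⟩
    (2 ^ 2) ^ d           ≡⟨ ^-*-assoc 2 2 d ⟩
    2 ^ (2 * d)           ≡⟨ *-identityˡ (2 ^ (2 * d)) ⟨
    1 * 2 ^ (2 * d)       ≡⟨ cong (_* 2 ^ (2 * d)) (^-zeroˡ d) ⟨
    1 ^ d * 2 ^ (2 * d)   ∎))
    where open ≡-Reasoning

  log₂≤⇒≤2^ : ∀ {d p a b} → Log₂≤ d p 1 a b → p ^ d * 2 ^ b ≤ 2 ^ a
  log₂≤⇒≤2^ {d} {p} {a} {b} (log₂≤ le) =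
    ≤-trans le (≤-reflexive (trans (cong (_* 2 ^ a) (^-zeroˡ d)) (*-identityˡ (2 ^ a))))

  -- Square-and-multiply on a binary exponent: the constant checks below need exponents up to 200000.
  infixr 8 _^ᵇ_

  _^ᵇ_ : ℕ → ℕᵇ → ℕ
  b ^ᵇ ℕᵇ.zero   = 1
  b ^ᵇ 1+[2 e ] = b * (b ^ᵇ e * b ^ᵇ e)
  b ^ᵇ 2[1+ e ] = (b * b ^ᵇ e) * (b * b ^ᵇ e)

  square≡^2* : ∀ b t → b ^ t * b ^ t ≡ b ^ (2 * t)
  square≡^2* b t = trans (sym (^-distribˡ-+-* b t t)) (cong (λ u → b ^ (t + u)) (sym (+-identityʳ t)))

  ^ᵇ-correct : ∀ b e → b ^ᵇ e ≡ b ^ ℕᵇ.toℕ e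
  ^ᵇ-correct b ℕᵇ.zero   = refl
  ^ᵇ-correct b 1+[2 e ] =
    cong (b *_) (trans (cong₂ _*_ (^ᵇ-correct b e) (^ᵇ-correct b e)) (square≡^2* b (ℕᵇ.toℕ e)))
  ^ᵇ-correct b 2[1+ e ] = trans (cong₂ _*_ b*b^e≡ b*b^e≡) (square≡^2* b (suc (ℕᵇ.toℕ e)))
    where b*b^e≡ = cong (b *_) (^ᵇ-correct b e)

  log₂≤-by-computation : ∀ d p q a b →
    T (p ^ᵇ ℕᵇ.fromℕ d * 2 ^ᵇ ℕᵇ.fromℕ b ≤ᵇ q ^ᵇ ℕᵇ.fromℕ d * 2 ^ᵇ ℕᵇ.fromℕ a) →
    Log₂≤ d p q a b
  log₂≤-by-computation d p q a b holds =
    log₂≤ (subst₂ _≤_ (cong₂ _*_ (fast p d) (fast 2 b)) (cong₂ _*_ (fast q d) (fast 2 a))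
                      (≤ᵇ⇒≤ _ _ holds))
    where
    fast : ∀ b e → b ^ᵇ ℕᵇ.fromℕ e ≡ b ^ e
    fast b e = trans (^ᵇ-correct b (ℕᵇ.fromℕ e)) (cong (b ^_) (ℕᵇ.toℕ-fromℕ e))

open import Defs
open import Data.Nat using (ℕ; _+_; _*_; _∸_; _^_; _≤_)
open import Data.Fin using (Fin)
open import Data.Vec using (Vec)
open import Data.List using (List; length)
open import Data.List.Relation.Unary.All using (All)
open import Data.List.Relation.Unary.Unique.Propositional using (Unique)
open import Data.Product using (_×_; _,_)

open import Data.Nat.Base using (suc; NonZero)
open import Data.Nat.Properties using (m^n≢0; m*n≢0; +-identityʳ; *-monoʳ-≤)
open import Relation.Binary.PropositionalEquality using (refl; subst; subst₂)
open import Data.Nat.Solver using (module +-*-Solver)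
open +-*-Solver
open Recurrence using (x; δ; ρ)
open ClearingDenominators using (num; den; count-bound; count-bound-at-2)
open Log₂Bounds

x⁻¹-log₂ : Log₂≤ D (den x) (num x) 1960000 0
x⁻¹-log₂ = log₂≤-raise (log₂≤-by-computation 25 (den x) (num x) 49 0 _) 40000

ρ-log₂ : Log₂≤ D (num ρ) (den ρ) 119000 0
ρ-log₂ = log₂≤-raise (log₂≤-by-computation 1000 (num ρ) (den ρ) 119 0 _) 1000

δ-log₂ : Log₂≤ D (num δ) (den δ) 0 967095
δ-log₂ = log₂≤-raise (log₂≤-by-computation 200000 (num δ) (den δ) 0 193419 _) 5

xδ-log₂ : Log₂≤ D (D * (num x * num δ)) (502466 * (den x * den δ)) 0 (2 * 967095)
xδ-log₂ = log₂≤-raise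
  (log₂≤-by-computation 100000 (D * (num x * num δ)) (502466 * (den x * den δ)) 0 193419 _) 10

prefactor-log₂ : ∀ n k → Log₂≤ D (num ρ ^ n * den x ^ k * 4) (den ρ ^ n * num x ^ k * 1)
                                 (119000 * n + 1960000 * k + 2000000) 0
prefactor-log₂ n k = log₂≤-* (log₂≤-* (log₂≤-^ ρ-log₂ n) (log₂≤-^ x⁻¹-log₂ k)) (log₂≤-4 D)

-- Explicit arguments: left to unification, Agda would normalise products such as den ρ * den ρ ^ n,
-- unfolding the multiplication by the numeral den ρ in unary.
prefactor-denominator≢0 : ∀ n k → NonZero (den ρ ^ n * num x ^ k * 1)
prefactor-denominator≢0 n k =
  m*n≢0 (den ρ ^ n * num x ^ k) 1 {{m*n≢0 (den ρ ^ n) (num x ^ k) {{m^n≢0 (den ρ) n}} {{m^n≢0 (num x) k}}}}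

part₁ : (n k j : ℕ) → 2 ≤ n → j ≤ n ∸ 1 →
        (L : List (Vec (Fin n) n)) → Unique L → All (InOLA⁺ n k j) L →
        length L ^ D * 2 ^ (967095 * j) ≤ 2 ^ (119000 * n + 1960000 * k + 2000000)
part₁ n@(suc _) k j _ _ L unique members = log₂≤⇒≤2^ L-log₂
  where
  rearranged : ∀ N X R RN XDk rn rd → (N * X) * ((1 * R) * rd) ≤ ((4 * RN) * rn) * (1 * XDk) →
               N * (R * X * 1 * rd) ≤ (RN * XDk * 4 * rn) * 1
  rearranged N X R RN XDk rn rd = subst₂ _≤_
    (solve 4 (λ N X R rd → (N :* X) :* ((con 1 :* R) :* rd) := N :* (R :* X :* con 1 :* rd)) refl N X R rd)
    (solve 3 (λ RN rn XDk → (con 4 :* RN :* rn) :* (con 1 :* XDk) := (RN :* XDk :* con 4 :* rn) :* con 1)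
       refl RN rn XDk)
  L-log₂ : Log₂≤ D (length L) 1 (119000 * n + 1960000 * k + 2000000) (967095 * j)
  L-log₂ = subst (λ a → Log₂≤ D (length L) 1 a (967095 * j)) (+-identityʳ _)
    (log₂≤-cancel (log₂≤-* (prefactor-log₂ n k) (log₂≤-^ δ-log₂ j))
       {{m*n≢0 (den ρ ^ n * num x ^ k * 1) (den δ ^ j) {{prefactor-denominator≢0 n k}} {{m^n≢0 (den δ) j}}}}
       (rearranged (length L) (num x ^ k) (den ρ ^ n) (num ρ ^ n) (den x ^ k) (num δ ^ j) (den δ ^ j)
          (count-bound L unique members)))

part₂ : (n k : ℕ) → 2 ≤ n → 2 ≤ n ∸ 1 →
        (L : List (Vec (Fin n) n)) → Unique L → All (InOLA⁺ n k 2) L →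
        (length L * D) ^ D * 2 ^ (2 * 967095) ≤ 502466 ^ D * 2 ^ (119000 * n + 1960000 * k + 2000000)
part₂ n@(suc _) k _ _ L unique members = cleared
  where
  rearranged : ∀ N X R RN XDk rn rd c e → (N * X) * ((1 * R) * rd) ≤ ((4 * RN) * rn) * (1 * XDk) →
               (N * e) * (R * X * 1 * (c * rd)) ≤ (RN * XDk * 4 * (e * rn)) * c
  rearranged N X R RN XDk rn rd c e le = subst₂ _≤_
    (solve 6 (λ N X R rd c e → e :* c :* ((N :* X) :* ((con 1 :* R) :* rd))
                             := (N :* e) :* (R :* X :* con 1 :* (c :* rd))) refl N X R rd c e)
    (solve 5 (λ RN rn XDk c e → e :* c :* ((con 4 :* RN :* rn) :* (con 1 :* XDk))
                              := (RN :* XDk :* con 4 :* (e :* rn)) :* c) refl RN rn XDk c e)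
    (*-monoʳ-≤ (e * c) le)
  L-log₂ : Log₂≤ D (length L * D) 502466 (119000 * n + 1960000 * k + 2000000) (2 * 967095)
  L-log₂ = subst (λ a → Log₂≤ D (length L * D) 502466 a (2 * 967095)) (+-identityʳ _)
    (log₂≤-cancel (log₂≤-* (prefactor-log₂ n k) xδ-log₂)
       {{m*n≢0 (den ρ ^ n * num x ^ k * 1) (502466 * (den x * den δ)) {{prefactor-denominator≢0 n k}}}}
       (rearranged (length L) (num x ^ k) (den ρ ^ n) (num ρ ^ n) (den x ^ k) (num x * num δ) (den x * den δ)
          502466 D (count-bound-at-2 L unique members)))
  -- Log₂≤.cleared L-log₂ would be checked against the goal first, normalising 502466 ^ D.
  open Log₂≤ L-log₂ using (cleared)

theorem3p2 : ((n k j : ℕ) → 2 ≤ n → j ≤ n ∸ 1 →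
    (L : List (Vec (Fin n) n)) → Unique L → All (InOLA⁺ n k j) L →
    length L ^ D * 2 ^ (967095 * j)
    ≤ 2 ^ (119000 * n + 1960000 * k + 2000000))
    ×
    ((n k : ℕ) → 2 ≤ n → 2 ≤ n ∸ 1 →
    (L : List (Vec (Fin n) n)) → Unique L → All (InOLA⁺ n k 2) L →
    (length L * D) ^ D * 2 ^ (2 * 967095)
    ≤ 502466 ^ D * 2 ^ (119000 * n + 1960000 * k + 2000000))
theorem3p2 = part₁ , part₂
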